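{- For all sequences of bins $\sigma$ and all integers $s',\ell'\ge 0$, $R(\sigma,s',0)=\mathrm{OPT}(\sigma,s',0)$ and $R(\sigma,0,\ell')=\mathrm{OPT}(\sigma,0,\ell')$.
   Context: Restricted Grid Scheduling setting: $S>1$ is an integer, $L=2S-1$, $M=4S-3$; bins have integer sizes in $[S,M]$ and $\sigma$ contains enough bins for all items to be packed. A packing is valid if each empty bin is smaller than every item packed in a later bin; its cost is the sum of sizes of bins receiving at least one item. $\mathrm{OPT}(\sigma,s,\ell)$ is the minimum cost of a valid packing of $s$ items of size $S$ and $\ell$ items of size $L$ into $\sigma$. A bin is wasteful if its empty space is at least as large as some item packed in a later bin; a packing is thrifty if no bin is wasteful. A partial packing is reasonable if every bin $b$ it packs contains: one item of size $S$ if $\mathrm{size}(b)\in[S,L-1]$; one item of size $L$ if $\mathrm{size}(b)=L$; two items of size $S$ or one of size $L$ if $\mathrm{size}(b)\in[L+1,L+S-1]$; one item of size $S$ and one of size $L$ if $\mathrm{size}(b)=L+S$; three items of size $S$ or one of size $S$ and one of size $L$ if $\mathrm{size}(b)\in[L+S+1,2L-1]$. The key bin of a packing is the first bin after which no items of size $L$ remain or at most two items of size $S$ remain; the front is the partial packing agreeing with the packing up to and including the key bin and empty afterwards. A packing is reasonable if it is thrifty and its front is reasonable. $R(\sigma,s,\ell)$ is the maximum cost of any reasonable packing of $s$ items of size $S$ and $\ell$ items of size $L$ into $\sigma$. -}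

module Defs where

open import Data.Nat using (ℕ; zero; suc; _+_; _*_; _∸_; _≤_; _<_)
open import Data.Product using (Σ; _×_; _,_; ∃)
open import Data.Sum using (_⊎_)
open import Data.List using (List; []; _∷_; map)
open import Data.List.Relation.Unary.All using (All)
open import Data.Unit using (⊤)
open import Relation.Nullary using (¬_)
open import Relation.Binary.PropositionalEquality using (_≡_)
open import Data.Product using (proj₁)

module _ (S : ℕ) where

  L : ℕ
  L = 2 * S ∸ 1

  M : ℕ
  M = 4 * S ∸ 3

  BinSize : ℕ → Set
  BinSize b = S ≤ b × b ≤ M

  -- A packed bin (b , x , y): bin of size b receiving x items of size S
  -- and y items of size L.  A packing into σ is a list of packed bins whose
  -- sizes, in order, are exactly σ (items of equal size are interchangeable,
  -- so a packing is determined by these counts).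
  PBin : Set
  PBin = ℕ × ℕ × ℕ

  size : PBin → ℕ
  size (b , _ , _) = b

  load : PBin → ℕ
  load (_ , x , y) = x * S + y * L

  Fits : PBin → Set
  Fits p = load p ≤ size p

  Empty : PBin → Set
  Empty (_ , x , y) = x ≡ 0 × y ≡ 0

  countS : List PBin → ℕ
  countS [] = 0
  countS ((_ , x , _) ∷ P) = x + countS P

  countL : List PBin → ℕ
  countL [] = 0
  countL ((_ , _ , y) ∷ P) = y + countL P

  IsPackingOf : List ℕ → ℕ → ℕ → List PBin → Set
  IsPackingOf σ s ℓ P = map size P ≡ σ × All Fits P × countS P ≡ s × countL P ≡ ℓ

  Valid : List PBin → Set
  Valid [] = ⊤
  Valid (p ∷ P) =
    (Empty p → (0 < countS P → size p < S) × (0 < countL P → size p < L)) × Valid P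

  binCost : PBin → ℕ
  binCost (b , zero , zero) = 0
  binCost (b , suc _ , _) = b
  binCost (b , zero , suc _) = b

  cost : List PBin → ℕ
  cost [] = 0
  cost (p ∷ P) = binCost p + cost P

  Wasteful : PBin → List PBin → Set
  Wasteful p P = (0 < countS P × S ≤ size p ∸ load p) ⊎ (0 < countL P × L ≤ size p ∸ load p)

  Thrifty : List PBin → Set
  Thrifty [] = ⊤
  Thrifty (p ∷ P) = ¬ Wasteful p P × Thrifty P

  ReasonableBin : PBin → Set
  ReasonableBin (b , x , y) =
      (S ≤ b × b < L × x ≡ 1 × y ≡ 0)
    ⊎ (b ≡ L × x ≡ 0 × y ≡ 1)
    ⊎ (L < b × b < L + S × ((x ≡ 2 × y ≡ 0) ⊎ (x ≡ 0 × y ≡ 1)))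
    ⊎ (b ≡ L + S × x ≡ 1 × y ≡ 1)
    ⊎ (L + S < b × b < 2 * L × ((x ≡ 3 × y ≡ 0) ⊎ (x ≡ 1 × y ≡ 1)))

  KeyReached : List PBin → Set
  KeyReached P = countL P ≡ 0 ⊎ countS P ≤ 2

  -- FrontReasonable P: every bin up to and including the key bin that
  -- receives at least one item is packed as in ReasonableBin.  Reading the
  -- packing left to right, once the remaining suffix satisfies KeyReached
  -- the front has ended (the key position may be before the first bin).
  FrontReasonable : List PBin → Set
  FrontReasonable [] = ⊤
  FrontReasonable (p ∷ P) =
    KeyReached (p ∷ P) ⊎ ((¬ Empty p → ReasonableBin p) × FrontReasonable P)

  Reasonable : List PBin → Set
  Reasonable P = Valid P × Thrifty P × FrontReasonable P

  EnoughBins : List ℕ → ℕ → ℕ → Set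
  EnoughBins σ s ℓ = Σ (List PBin) λ P → IsPackingOf σ s ℓ P × Valid P

  IsOPT : List ℕ → ℕ → ℕ → ℕ → Set
  IsOPT σ s ℓ v =
    (Σ (List PBin) λ P → IsPackingOf σ s ℓ P × Valid P × cost P ≡ v)
    × (∀ P → IsPackingOf σ s ℓ P → Valid P → v ≤ cost P)

  IsR : List ℕ → ℕ → ℕ → ℕ → Set
  IsR σ s ℓ v =
    (Σ (List PBin) λ P → IsPackingOf σ s ℓ P × Reasonable P × cost P ≡ v)
    × (∀ P → IsPackingOf σ s ℓ P → Reasonable P → cost P ≤ v)

-- Every reasonable packing is valid and thrifty, so R and OPT both equal the cost of a reasonable
-- packing G as soon as every valid thrifty packing costs no more than any valid packing of the same
-- items. With items of one size only, G is the greedy packing that fills each bin as far as possible;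
-- its front is vacuously reasonable because one of the two item kinds is absent.
-- For S-items, a thrifty packing never has more items left after a bin than another packing has,
-- while a valid packing leaves no bin of size at least S empty as long as S-items remain; hence every
-- bin used by a thrifty packing is also used by any valid one.
-- For L-items, a bin of size at most M < 2L holds at most one item, and the same comparison works
-- between any two valid packings.
module Submission where

open import Defs
open import Data.Nat
  using (ℕ; NonZero; >-nonZero; zero; suc; _+_; _*_; _∸_; _⊓_; _≤_; _<_; z≤n; s≤s⁻¹; z<s; _/_)
open import Data.Nat.Properties
open import Data.Nat.DivMod
  using (m%n≡m∸m/n*n; m%n<n; m/n*n≤m; m*n/n≡m; /-monoˡ-≤; m/n≡0⇒m<n; m<n⇒m/n≡0; m<n*o⇒m/o<n)
open import Data.Nat.ListAction using (sum)
open import Data.Nat.Tactic.RingSolver using (solve-∀)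
open import Data.Product using (_×_; ∃; _,_; proj₁; proj₂)
open import Data.Sum using (inj₁; inj₂)
open import Data.List using (List; []; _∷_; map)
open import Data.List.Properties using (∷-injective)
open import Data.List.Relation.Unary.All using (All; []; _∷_)
import Data.List.Relation.Unary.All as All
open import Data.Empty using (⊥-elim)
open import Data.Unit using (tt)
open import Relation.Nullary using (¬_)
open import Relation.Binary.PropositionalEquality
  using (_≡_; refl; sym; trans; cong; subst; subst₂; module ≡-Reasoning)

m*n≤o⇒m≤o/n : ∀ {m o} n .{{_ : NonZero n}} → m * n ≤ o → m ≤ o / n
m*n≤o⇒m≤o/n {m} n le = subst (_≤ _) (m*n/n≡m m n) (/-monoˡ-≤ n le)

m∸[m/n]*n<n : ∀ m n .{{_ : NonZero n}} → m ∸ m / n * n < n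
m∸[m/n]*n<n m n = subst (_< n) (m%n≡m∸m/n*n m n) (m%n<n m n)

[o⊓m/n]*n≤m : ∀ o m n .{{_ : NonZero n}} → (o ⊓ (m / n)) * n ≤ m
[o⊓m/n]*n≤m o m n = ≤-trans (*-monoˡ-≤ n (m⊓n≤n o (m / n))) (m/n*n≤m m n)

m∸n*o<o⇒p*o≤m⇒p≤n : ∀ {m n o p} → m ∸ n * o < o → p * o ≤ m → p ≤ n
m∸n*o<o⇒p*o≤m⇒p≤n {m} {n} {o} {p} slack le = s≤s⁻¹ (*-cancelʳ-< o p (suc n) (begin-strict
  p * o             ≤⟨ le ⟩
  m                 ≤⟨ m≤n+m∸n m (n * o) ⟩
  n * o + (m ∸ n * o) <⟨ +-monoʳ-< (n * o) slack ⟩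
  n * o + o         ≡⟨ +-comm (n * o) o ⟩
  suc n * o         ∎))
  where open ≤-Reasoning

0<m≤n∸o⇒n⊓o≡o : ∀ {m n o} → 0 < m → m ≤ n ∸ o → n ⊓ o ≡ o
0<m≤n∸o⇒n⊓o≡o pos le =
  m≥n⇒m⊓n≡n (<⇒≤ (m∸n≢0⇒n<m λ e → <⇒≱ pos (≤-trans le (≤-reflexive e))))

m⊓n+[m∸n]≡m : ∀ m n → m ⊓ n + (m ∸ n) ≡ m
m⊓n+[m∸n]≡m m n = trans (cong (_+ (m ∸ n)) (⊓-comm m n)) (m⊓n+n∸m≡n n m)

L-suc : ∀ k → L (suc k) ≡ suc (2 * k)
L-suc k = cong (_∸ 1) (*-suc 2 k)

M-suc : ∀ k → M (suc k) ≡ suc (4 * k)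
M-suc k = cong (_∸ 3) (*-suc 4 k)

L-nonZero : ∀ S .{{_ : NonZero S}} → NonZero (L S)
L-nonZero (suc k) = >-nonZero (subst (0 <_) (sym (L-suc k)) z<s)

M<2*L : ∀ S .{{_ : NonZero S}} → M S < 2 * L S
M<2*L (suc k) = subst₂ _<_ (sym (M-suc k)) (cong (2 *_) (sym (L-suc k))) (≤-reflexive (sym (twice k)))
  where
  twice : ∀ k → 2 * suc (2 * k) ≡ suc (suc (4 * k))
  twice = solve-∀

module _ (S : ℕ) where

  binCost≡size : ∀ {b x y} → ¬ Empty S (b , x , y) → binCost S (b , x , y) ≡ b
  binCost≡size {x = zero} {zero} nonEmpty = ⊥-elim (nonEmpty (refl , refl))
  binCost≡size {x = suc _} _ = refl
  binCost≡size {x = zero} {suc _} _ = refl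

  binCost-mono : ∀ {b x y x′ y′} → (¬ Empty S (b , x , y) → ¬ Empty S (b , x′ , y′)) →
                 binCost S (b , x , y) ≤ binCost S (b , x′ , y′)
  binCost-mono {x = zero} {zero} _ = z≤n
  binCost-mono {x = suc _} used = ≤-reflexive (sym (binCost≡size (used λ { (() , _) })))
  binCost-mono {x = zero} {suc _} used = ≤-reflexive (sym (binCost≡size (used λ { (_ , ()) })))

  keyReached⇒frontReasonable : ∀ P → KeyReached S P → FrontReasonable S P
  keyReached⇒frontReasonable [] _ = tt
  keyReached⇒frontReasonable (p ∷ P) key = inj₁ key

  nonEmpty-before-S : ∀ {b x y P} → Valid S ((b , x , y) ∷ P) → S ≤ b → 0 < x + countS S P →
                      ¬ Empty S (b , x , y)
  nonEmpty-before-S (valid , _) S≤b pos (refl , refl) = <⇒≱ (proj₁ (valid (refl , refl)) pos) S≤b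

  nonEmpty-before-L : ∀ {b x y P} → Valid S ((b , x , y) ∷ P) → L S ≤ b → 0 < y + countL S P →
                      ¬ Empty S (b , x , y)
  nonEmpty-before-L (valid , _) L≤b pos (refl , refl) = <⇒≱ (proj₂ (valid (refl , refl)) pos) L≤b

  ThriftyValidOptimal : List ℕ → ℕ → ℕ → Set
  ThriftyValidOptimal σ s ℓ = ∀ Q P → IsPackingOf S σ s ℓ Q → IsPackingOf S σ s ℓ P →
    Valid S Q → Thrifty S Q → Valid S P → cost S Q ≤ cost S P

  thriftyValidOptimal⇒R≡OPT : ∀ {σ s ℓ} G → IsPackingOf S σ s ℓ G → Reasonable S G →
    ThriftyValidOptimal σ s ℓ → ∃ λ v → IsR S σ s ℓ v × IsOPT S σ s ℓ v
  thriftyValidOptimal⇒R≡OPT G packs reasonable@(valid , thrifty , _) optimal =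
    cost S G ,
    ((G , packs , reasonable , refl) ,
       λ Q packsQ (validQ , thriftyQ , _) → optimal Q G packsQ packs validQ thriftyQ valid) ,
    ((G , packs , valid , refl) ,
       λ P packsP validP → optimal G P packs packsP valid thrifty validP)

  thrifty⇒countS-suffix-≤ : ∀ {b} xq xp Q P → ¬ Wasteful S (b , xq , 0) Q → xp * S ≤ b →
    xq + countS S Q ≤ xp + countS S P → countS S Q ≤ countS S P
  thrifty⇒countS-suffix-≤ {b} xq xp Q P notWasteful fits counts with countS S Q
  ... | zero = z≤n
  ... | suc _ = +-cancelˡ-≤ xq _ _ (≤-trans counts (+-monoˡ-≤ (countS S P) xp≤xq))
    where
    slack : b ∸ xq * S < S
    slack = subst (λ a → b ∸ a < S) (+-identityʳ (xq * S))
              (≰⇒> λ S≤slack → notWasteful (inj₁ (z<s , S≤slack)))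
    xp≤xq : xp ≤ xq
    xp≤xq = m∸n*o<o⇒p*o≤m⇒p≤n slack fits

  thrifty-cost≤valid-cost-S : ∀ Q P → map (size S) Q ≡ map (size S) P → All (S ≤_) (map (size S) P) →
    All (Fits S) P → Thrifty S Q → Valid S P → countL S Q ≡ 0 → countS S Q ≤ countS S P →
    cost S Q ≤ cost S P
  thrifty-cost≤valid-cost-S [] [] _ _ _ _ _ _ _ = z≤n
  thrifty-cost≤valid-cost-S ((b , xq , zero) ∷ Q) ((b′ , xp , yp) ∷ P) sizes (S≤b ∷ S≤σ) (fits ∷ fitsP)
                            (notWasteful , thriftyQ) validP noL counts with ∷-injective sizes
  ... | refl , sizes′ =
    +-mono-≤ (binCost-mono λ nonEmpty →
                nonEmpty-before-S validP S≤b (≤-trans (nonEmpty⇒0<items nonEmpty) counts))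
             (thrifty-cost≤valid-cost-S Q P sizes′ S≤σ fitsP thriftyQ (proj₂ validP) noL
               (thrifty⇒countS-suffix-≤ xq xp Q P notWasteful (≤-trans (m≤m+n (xp * S) (yp * L S)) fits) counts))
    where
    nonEmpty⇒0<items : ¬ Empty S (b , xq , 0) → 0 < xq + countS S Q
    nonEmpty⇒0<items nonEmpty = ≤-trans (n≢0⇒n>0 λ xq≡0 → nonEmpty (xq≡0 , refl)) (m≤m+n xq (countS S Q))

  thriftyValidOptimal-S : ∀ {σ s} → All (S ≤_) σ → ThriftyValidOptimal σ s 0
  thriftyValidOptimal-S S≤σ Q P (sizesQ , _ , countQ , noL) (sizesP , fitsP , countP , _) _ thriftyQ validP =
    thrifty-cost≤valid-cost-S Q P (trans sizesQ (sym sizesP)) (subst (All (S ≤_)) (sym sizesP) S≤σ)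
      fitsP thriftyQ validP noL (≤-reflexive (trans countQ (sym countP)))

module _ (S : ℕ) .{{_ : NonZero S}} where

  instance
    L≢0 : NonZero (L S)
    L≢0 = L-nonZero S

  m≤M⇒m/L≤1 : ∀ {m} → m ≤ M S → m / L S ≤ 1
  m≤M⇒m/L≤1 m≤M = s≤s⁻¹ (m<n*o⇒m/o<n {o = L S} (≤-<-trans m≤M (M<2*L S)))

  valid⇒countL-suffix-≤ : ∀ {b} yq yp Q P → Valid S ((b , 0 , yq) ∷ Q) → yq ≤ b / L S → yp ≤ b / L S →
    b ≤ M S → yq + countL S Q ≤ yp + countL S P → countL S Q ≤ countL S P
  valid⇒countL-suffix-≤ (suc _) yp Q P _ _ yp≤ b≤M counts =
    ≤-trans (m≤n+m (countL S Q) _)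
      (s≤s⁻¹ (≤-trans counts (+-monoˡ-≤ (countL S P) (≤-trans yp≤ (m≤M⇒m/L≤1 b≤M)))))
  valid⇒countL-suffix-≤ zero yp Q P (valid , _) _ yp≤ _ counts with countL S Q
  ... | zero = z≤n
  ... | suc _ = subst (λ y → suc _ ≤ y + countL S P) yp≡0 counts
    where
    yp≡0 : yp ≡ 0
    yp≡0 = n≤0⇒n≡0 (≤-trans yp≤ (≤-reflexive (m<n⇒m/n≡0 (proj₂ (valid (refl , refl)) z<s))))

  valid-cost≤valid-cost-L : ∀ Q P → map (size S) Q ≡ map (size S) P → All (_≤ M S) (map (size S) P) →
    All (Fits S) Q → All (Fits S) P → Valid S Q → Valid S P → countS S Q ≡ 0 → countS S P ≡ 0 →
    countL S Q ≤ countL S P → cost S Q ≤ cost S P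
  valid-cost≤valid-cost-L [] [] _ _ _ _ _ _ _ _ _ = z≤n
  valid-cost≤valid-cost-L ((b , zero , yq) ∷ Q) ((b′ , zero , yp) ∷ P) sizes (b≤M ∷ σ≤M)
                          (fitsq ∷ fitsQ) (fitsp ∷ fitsP) validQ validP noSQ noSP counts with ∷-injective sizes
  ... | refl , sizes′ =
    +-mono-≤ (binCost-mono S λ nonEmpty → nonEmpty-before-L S validP (L≤b nonEmpty)
                                             (≤-trans (≤-trans (nonEmpty⇒0<yq nonEmpty) (m≤m+n yq (countL S Q))) counts))
             (valid-cost≤valid-cost-L Q P sizes′ σ≤M fitsQ fitsP (proj₂ validQ) (proj₂ validP) noSQ noSP
               (valid⇒countL-suffix-≤ yq yp Q P validQ (m*n≤o⇒m≤o/n (L S) fitsq) (m*n≤o⇒m≤o/n (L S) fitsp)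
                 b≤M counts))
    where
    nonEmpty⇒0<yq : ¬ Empty S (b , 0 , yq) → 0 < yq
    nonEmpty⇒0<yq nonEmpty = n≢0⇒n>0 λ yq≡0 → nonEmpty (refl , yq≡0)
    L≤b : ¬ Empty S (b , 0 , yq) → L S ≤ b
    L≤b nonEmpty = ≤-trans (m≤n*m (L S) yq {{>-nonZero (nonEmpty⇒0<yq nonEmpty)}}) fitsq

  validOptimal-L : ∀ {σ ℓ} → All (_≤ M S) σ → ThriftyValidOptimal S σ 0 ℓ
  validOptimal-L σ≤M Q P (sizesQ , fitsQ , noSQ , countQ) (sizesP , fitsP , noSP , countP) validQ _ validP =
    valid-cost≤valid-cost-L Q P (trans sizesQ (sym sizesP)) (subst (All (_≤ M S)) (sym sizesP) σ≤M)
      fitsQ fitsP validQ validP noSQ noSP (≤-reflexive (trans countQ (sym countP)))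

  greedyS : List ℕ → ℕ → List (PBin S)
  greedyS [] n = []
  greedyS (b ∷ σ) n = (b , n ⊓ (b / S) , 0) ∷ greedyS σ (n ∸ b / S)

  capacityS : List ℕ → ℕ
  capacityS σ = sum (map (_/ S) σ)

  sizes-greedyS : ∀ σ n → map (size S) (greedyS σ n) ≡ σ
  sizes-greedyS [] n = refl
  sizes-greedyS (b ∷ σ) n = cong (b ∷_) (sizes-greedyS σ (n ∸ b / S))

  fits-greedyS : ∀ σ n → All (Fits S) (greedyS σ n)
  fits-greedyS [] n = []
  fits-greedyS (b ∷ σ) n =
    subst (_≤ b) (sym (+-identityʳ _)) ([o⊓m/n]*n≤m n b S) ∷ fits-greedyS σ (n ∸ b / S)

  countL-greedyS : ∀ σ n → countL S (greedyS σ n) ≡ 0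
  countL-greedyS [] n = refl
  countL-greedyS (b ∷ σ) n = countL-greedyS σ (n ∸ b / S)

  countS-greedyS-≤ : ∀ σ n → countS S (greedyS σ n) ≤ n
  countS-greedyS-≤ [] n = z≤n
  countS-greedyS-≤ (b ∷ σ) n = begin
    n ⊓ (b / S) + countS S (greedyS σ (n ∸ b / S)) ≤⟨ +-monoʳ-≤ (n ⊓ (b / S)) (countS-greedyS-≤ σ _) ⟩
    n ⊓ (b / S) + (n ∸ b / S)                      ≡⟨ m⊓n+[m∸n]≡m n (b / S) ⟩
    n                                              ∎
    where open ≤-Reasoning

  countS-greedyS : ∀ σ n → n ≤ capacityS σ → countS S (greedyS σ n) ≡ n
  countS-greedyS [] n n≤0 = sym (n≤0⇒n≡0 n≤0)
  countS-greedyS (b ∷ σ) n n≤capacity = begin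
    n ⊓ (b / S) + countS S (greedyS σ (n ∸ b / S)) ≡⟨ cong (n ⊓ (b / S) +_) rest ⟩
    n ⊓ (b / S) + (n ∸ b / S)                      ≡⟨ m⊓n+[m∸n]≡m n (b / S) ⟩
    n                                              ∎
    where
    open ≡-Reasoning
    rest : countS S (greedyS σ (n ∸ b / S)) ≡ n ∸ b / S
    rest = countS-greedyS σ _ (m≤n+o⇒m∸n≤o n (b / S) n≤capacity)

  full-before-greedyS : ∀ σ n b → 0 < countS S (greedyS σ (n ∸ b / S)) → n ⊓ (b / S) ≡ b / S
  full-before-greedyS σ n b pos = 0<m≤n∸o⇒n⊓o≡o pos (countS-greedyS-≤ σ (n ∸ b / S))

  valid-greedyS : ∀ σ n → Valid S (greedyS σ n)
  valid-greedyS [] n = tt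
  valid-greedyS (b ∷ σ) n = emptyHead , valid-greedyS σ (n ∸ b / S)
    where
    emptyHead : Empty S (b , n ⊓ (b / S) , 0) →
      (0 < countS S (greedyS σ (n ∸ b / S)) → b < S) × (0 < countL S (greedyS σ (n ∸ b / S)) → b < L S)
    emptyHead (empty , _) =
      (λ pos → m/n≡0⇒m<n (trans (sym (full-before-greedyS σ n b pos)) empty)) ,
      (λ pos → ⊥-elim (n>0⇒n≢0 pos (countL-greedyS σ _)))

  thrifty-greedyS : ∀ σ n → Thrifty S (greedyS σ n)
  thrifty-greedyS [] n = tt
  thrifty-greedyS (b ∷ σ) n = notWasteful , thrifty-greedyS σ (n ∸ b / S)
    where
    notWasteful : ¬ Wasteful S (b , n ⊓ (b / S) , 0) (greedyS σ (n ∸ b / S))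
    notWasteful (inj₁ (pos , S≤slack)) = <⇒≱ slack<S S≤slack
      where
      slack<S : b ∸ (n ⊓ (b / S) * S + 0) < S
      slack<S = subst (λ a → b ∸ a < S)
                  (sym (trans (+-identityʳ _) (cong (_* S) (full-before-greedyS σ n b pos))))
                  (m∸[m/n]*n<n b S)
    notWasteful (inj₂ (pos , _)) = n>0⇒n≢0 pos (countL-greedyS σ _)

  reasonable-greedyS : ∀ σ n → Reasonable S (greedyS σ n)
  reasonable-greedyS σ n =
    valid-greedyS σ n , thrifty-greedyS σ n , keyReached⇒frontReasonable S _ (inj₁ (countL-greedyS σ n))

  countS≤capacityS : ∀ P → All (Fits S) P → countS S P ≤ capacityS (map (size S) P)
  countS≤capacityS [] [] = z≤n
  countS≤capacityS ((b , x , y) ∷ P) (fits ∷ fitsP) =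
    +-mono-≤ (m*n≤o⇒m≤o/n S (≤-trans (m≤m+n (x * S) (y * L S)) fits)) (countS≤capacityS P fitsP)

  packs-greedyS : ∀ {σ s} → EnoughBins S σ s 0 → IsPackingOf S σ s 0 (greedyS σ s)
  packs-greedyS {σ} {s} (P , (sizes , fits , refl , _) , _) =
    sizes-greedyS σ s , fits-greedyS σ s ,
    countS-greedyS σ s (subst (λ σ → countS S P ≤ capacityS σ) sizes (countS≤capacityS P fits)) ,
    countL-greedyS σ s

  greedyL : List ℕ → ℕ → List (PBin S)
  greedyL [] n = []
  greedyL (b ∷ σ) n = (b , 0 , n ⊓ (b / L S)) ∷ greedyL σ (n ∸ b / L S)

  capacityL : List ℕ → ℕ
  capacityL σ = sum (map (_/ L S) σ)

  sizes-greedyL : ∀ σ n → map (size S) (greedyL σ n) ≡ σ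
  sizes-greedyL [] n = refl
  sizes-greedyL (b ∷ σ) n = cong (b ∷_) (sizes-greedyL σ (n ∸ b / L S))

  fits-greedyL : ∀ σ n → All (Fits S) (greedyL σ n)
  fits-greedyL [] n = []
  fits-greedyL (b ∷ σ) n = [o⊓m/n]*n≤m n b (L S) ∷ fits-greedyL σ (n ∸ b / L S)

  countS-greedyL : ∀ σ n → countS S (greedyL σ n) ≡ 0
  countS-greedyL [] n = refl
  countS-greedyL (b ∷ σ) n = countS-greedyL σ (n ∸ b / L S)

  countL-greedyL-≤ : ∀ σ n → countL S (greedyL σ n) ≤ n
  countL-greedyL-≤ [] n = z≤n
  countL-greedyL-≤ (b ∷ σ) n = begin
    n ⊓ (b / L S) + countL S (greedyL σ (n ∸ b / L S)) ≤⟨ +-monoʳ-≤ (n ⊓ (b / L S)) (countL-greedyL-≤ σ _) ⟩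
    n ⊓ (b / L S) + (n ∸ b / L S)                      ≡⟨ m⊓n+[m∸n]≡m n (b / L S) ⟩
    n                                                  ∎
    where open ≤-Reasoning

  countL-greedyL : ∀ σ n → n ≤ capacityL σ → countL S (greedyL σ n) ≡ n
  countL-greedyL [] n n≤0 = sym (n≤0⇒n≡0 n≤0)
  countL-greedyL (b ∷ σ) n n≤capacity = begin
    n ⊓ (b / L S) + countL S (greedyL σ (n ∸ b / L S)) ≡⟨ cong (n ⊓ (b / L S) +_) rest ⟩
    n ⊓ (b / L S) + (n ∸ b / L S)                      ≡⟨ m⊓n+[m∸n]≡m n (b / L S) ⟩
    n                                                  ∎
    where
    open ≡-Reasoning
    rest : countL S (greedyL σ (n ∸ b / L S)) ≡ n ∸ b / L S
    rest = countL-greedyL σ _ (m≤n+o⇒m∸n≤o n (b / L S) n≤capacity)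

  full-before-greedyL : ∀ σ n b → 0 < countL S (greedyL σ (n ∸ b / L S)) → n ⊓ (b / L S) ≡ b / L S
  full-before-greedyL σ n b pos = 0<m≤n∸o⇒n⊓o≡o pos (countL-greedyL-≤ σ (n ∸ b / L S))

  valid-greedyL : ∀ σ n → Valid S (greedyL σ n)
  valid-greedyL [] n = tt
  valid-greedyL (b ∷ σ) n = emptyHead , valid-greedyL σ (n ∸ b / L S)
    where
    emptyHead : Empty S (b , 0 , n ⊓ (b / L S)) →
      (0 < countS S (greedyL σ (n ∸ b / L S)) → b < S) × (0 < countL S (greedyL σ (n ∸ b / L S)) → b < L S)
    emptyHead (_ , empty) =
      (λ pos → ⊥-elim (n>0⇒n≢0 pos (countS-greedyL σ _))) ,
      (λ pos → m/n≡0⇒m<n (trans (sym (full-before-greedyL σ n b pos)) empty))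

  thrifty-greedyL : ∀ σ n → Thrifty S (greedyL σ n)
  thrifty-greedyL [] n = tt
  thrifty-greedyL (b ∷ σ) n = notWasteful , thrifty-greedyL σ (n ∸ b / L S)
    where
    notWasteful : ¬ Wasteful S (b , 0 , n ⊓ (b / L S)) (greedyL σ (n ∸ b / L S))
    notWasteful (inj₁ (pos , _)) = n>0⇒n≢0 pos (countS-greedyL σ _)
    notWasteful (inj₂ (pos , L≤slack)) = <⇒≱ slack<L L≤slack
      where
      slack<L : b ∸ n ⊓ (b / L S) * L S < L S
      slack<L = subst (λ a → b ∸ a * L S < L S) (sym (full-before-greedyL σ n b pos)) (m∸[m/n]*n<n b (L S))

  reasonable-greedyL : ∀ σ n → Reasonable S (greedyL σ n)
  reasonable-greedyL σ n =
    valid-greedyL σ n , thrifty-greedyL σ n ,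
    keyReached⇒frontReasonable S _ (inj₂ (≤-trans (≤-reflexive (countS-greedyL σ n)) z≤n))

  countL≤capacityL : ∀ P → All (Fits S) P → countL S P ≤ capacityL (map (size S) P)
  countL≤capacityL [] [] = z≤n
  countL≤capacityL ((b , x , y) ∷ P) (fits ∷ fitsP) =
    +-mono-≤ (m*n≤o⇒m≤o/n (L S) (≤-trans (m≤n+m (y * L S) (x * S)) fits)) (countL≤capacityL P fitsP)

  packs-greedyL : ∀ {σ ℓ} → EnoughBins S σ 0 ℓ → IsPackingOf S σ 0 ℓ (greedyL σ ℓ)
  packs-greedyL {σ} {ℓ} (P , (sizes , fits , _ , refl) , _) =
    sizes-greedyL σ ℓ , fits-greedyL σ ℓ , countS-greedyL σ ℓ ,
    countL-greedyL σ ℓ (subst (λ σ → countL S P ≤ capacityL σ) sizes (countL≤capacityL P fits))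

proposition3 : (S : ℕ) → 1 < S → (σ : List ℕ) → All (BinSize S) σ → (s' ℓ' : ℕ) →
    (EnoughBins S σ s' 0 → ∃ λ v → IsR S σ s' 0 v × IsOPT S σ s' 0 v)
    × (EnoughBins S σ 0 ℓ' → ∃ λ v → IsR S σ 0 ℓ' v × IsOPT S σ 0 ℓ' v)
proposition3 S 1<S σ binSizes s' ℓ' = onlyS , onlyL
  where
  instance
    S≢0 : NonZero S
    S≢0 = >-nonZero (<-trans z<s 1<S)

  onlyS : EnoughBins S σ s' 0 → ∃ λ v → IsR S σ s' 0 v × IsOPT S σ s' 0 v
  onlyS enough = thriftyValidOptimal⇒R≡OPT S (greedyS S σ s') (packs-greedyS S enough)
    (reasonable-greedyS S σ s') (thriftyValidOptimal-S S (All.map proj₁ binSizes))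

  onlyL : EnoughBins S σ 0 ℓ' → ∃ λ v → IsR S σ 0 ℓ' v × IsOPT S σ 0 ℓ' v
  onlyL enough = thriftyValidOptimal⇒R≡OPT S (greedyL S σ ℓ') (packs-greedyL S enough)
    (reasonable-greedyL S σ ℓ') (validOptimal-L S (All.map proj₂ binSizes))
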